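{- The adjunction $\mathbbm{2}^-\dashv\mathbbm{2}^-$ between $\mathsf{Pos}^{\mathrm{op}}$ and $\mathsf{Pos}$ (homming into $\mathbbm{2}$), extended to horizontal arrows by $r\mapsto\overline{\mathbbm{2}}(r)$ where $(A,B)\in\overline{\mathbbm{2}}(r)$ iff $r[A]\subseteq B$, is a framed (and op-framed) adjunction $\mathbbm{2}^-\dashv\mathbbm{2}^-:\mathbb{S}\mathsf{Pos}^{\mathrm{op}}\to\mathbb{S}\mathsf{Pos}$.
   Context: $\mathbbm{2}=\{0<1\}$; for a poset $X$, $\mathbbm{2}^X$ is the poset of monotone maps $X\to\mathbbm{2}$ (up-sets ordered by inclusion) and $\mathbbm{2}^f$ is precomposition. A weakening relation $r:X\looparrowright Y$ is a subset of $X\times Y$ with $x'\le x\,r\,y\le y'\Rightarrow x'ry'$, and $r[A]=\{y\mid\exists x\in A.\ xry\}$. $\mathbb{S}\mathsf{Pos}$ is the framed bicategory (strict double category) whose objects are posets, vertical arrows monotone maps, horizontal arrows weakening relations (composed relationally), and with a unique 2-cell from $S:A\looparrowright B$ to $R:C\looparrowright D$ along vertical $f:A\to C$, $g:B\to D$ iff $S\subseteq R(f,g)=\{(a,b)\mid (f(a),g(b))\in R\}$; $\mathbb{S}\mathsf{Pos}^{\mathrm{op}}$ reverses the vertical arrows. Framed (resp. op-framed) adjunctions are in the sense of Shulman ("Framed bicategories and monoidal fibrations"). -}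

module Defs where

open import Level using (0ℓ)
open import Data.Bool using (Bool; true; false)
import Data.Bool.Properties as BoolP
open import Data.Product using (Σ; ∃; _×_; _,_)
open import Relation.Binary.Bundles using (Poset)
open import Relation.Binary.Morphism.Bundles using (PosetHomomorphism; mkPosetHomo)
import Relation.Binary.Morphism.Construct.Identity as Id
import Relation.Binary.Morphism.Construct.Composition as Comp
open import Relation.Binary.PropositionalEquality as Eq using (_≡_)

Pos₀ : Set₁
Pos₀ = Poset 0ℓ 0ℓ 0ℓ

Mono : Pos₀ → Pos₀ → Set
Mono X Y = PosetHomomorphism X Y

open PosetHomomorphism public using (⟦_⟧)

idM : {X : Pos₀} → Mono X X
idM {X} = Id.posetHomomorphism X

-- g ∘M f  is "first f, then g"
_∘M_ : {X Y Z : Pos₀} → Mono Y Z → Mono X Y → Mono X Z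
g ∘M f = Comp.posetHomomorphism f g

_≈M_ : {X Y : Pos₀} → Mono X Y → Mono X Y → Set
_≈M_ {X} {Y} f g = ∀ x → Poset._≈_ Y (⟦ f ⟧ x) (⟦ g ⟧ x)

-- The poset 2 = {false < true} and 2^X (monotone maps X → 2, i.e.
-- up-sets, ordered pointwise = by inclusion)

𝟚 : Pos₀
𝟚 = BoolP.≤-poset

module _ (X : Pos₀) where
  private
    module X = Poset X
    module B = Poset 𝟚

  UpSet : Set
  UpSet = Mono X 𝟚

  _≈U_ : UpSet → UpSet → Set
  A ≈U A' = ∀ x → ⟦ A ⟧ x ≡ ⟦ A' ⟧ x

  _≤U_ : UpSet → UpSet → Set
  A ≤U A' = ∀ x → ⟦ A ⟧ x B.≤ ⟦ A' ⟧ x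

  𝟚^ : Pos₀
  𝟚^ = record
    { Carrier = UpSet
    ; _≈_ = _≈U_
    ; _≤_ = _≤U_
    ; isPartialOrder = record
      { isPreorder = record
        { isEquivalence = record
          { refl = λ x → Eq.refl
          ; sym = λ p x → Eq.sym (p x)
          ; trans = λ p q x → Eq.trans (p x) (q x) }
        ; reflexive = λ p x → B.reflexive (p x)
        ; trans = λ p q x → B.trans (p x) (q x) }
      ; antisym = λ p q x → B.antisym (p x) (q x) }
    }

_∈U_ : {X : Pos₀} → Poset.Carrier X → UpSet X → Set
x ∈U A = ⟦ A ⟧ x ≡ true

𝟚^map : {X Y : Pos₀} → Mono X Y → Mono (𝟚^ Y) (𝟚^ X)
𝟚^map {X} {Y} f = mkPosetHomo (𝟚^ Y) (𝟚^ X) (λ A → A ∘M f) (λ p x → p (⟦ f ⟧ x))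

ev : (X : Pos₀) → Mono X (𝟚^ (𝟚^ X))
ev X = mkPosetHomo X (𝟚^ (𝟚^ X)) (λ x → mkPosetHomo (𝟚^ X) 𝟚 (λ A → ⟦ A ⟧ x) (λ p → p x))
                                 (λ x≤y A → PosetHomomorphism.mono A x≤y)

record WRel (X Y : Pos₀) : Set₁ where
  private
    module X = Poset X
    module Y = Poset Y
  field
    rel  : X.Carrier → Y.Carrier → Set
    weak : ∀ {x' x y y'} → x' X.≤ x → rel x y → y Y.≤ y' → rel x' y'
open WRel public

_⊙W_ : {X Y Z : Pos₀} → WRel X Y → WRel Y Z → WRel X Z
_⊙W_ {X} {Y} {Z} r s = record
  { rel  = λ x z → ∃ λ y → rel r x y × rel s y z
  ; weak = λ x'≤x (y , rxy , syz) z≤z' →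
      y , weak r x'≤x rxy (Poset.refl Y) , weak s (Poset.refl Y) syz z≤z' }

UW : (X : Pos₀) → WRel X X
UW X = record
  { rel = Poset._≤_ X
  ; weak = λ p q r → Poset.trans X p (Poset.trans X q r) }

-- the unique 2-cell S ⇒ R along f, g exists iff  S ⊆ R(f,g)
CellW : {A B C D : Pos₀} → WRel A B → WRel C D → Mono A C → Mono B D → Set
CellW S R f g = ∀ {a b} → rel S a b → rel R (⟦ f ⟧ a) (⟦ g ⟧ b)

𝟚̄ : {X Y : Pos₀} → WRel X Y → WRel (𝟚^ X) (𝟚^ Y)
𝟚̄ {X} {Y} r = record
  { rel  = λ A B → ∀ {x y} → x ∈U A → rel r x y → y ∈U B
  ; weak = λ {A'} {A} {B} {B'} A'≤A h B≤B' {x} {y} x∈A' rxy →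
      up (B≤B' y) (h (up (A'≤A x) x∈A') rxy) }
  where
  up : ∀ {b c : Bool} → Poset._≤_ 𝟚 b c → b ≡ true → c ≡ true
  up Data.Bool.b≤b e = e

-- Locally thin double categories (at most one 2-cell with given
-- boundary, so the 2-cells are given by a predicate).

record ThinDbl : Set₂ where
  field
    Obj  : Set₁
    Ver  : Obj → Obj → Set
    _≈v_ : ∀ {A B} → Ver A B → Ver A B → Set
    idv  : ∀ {A} → Ver A A
    _∘v_ : ∀ {A B C} → Ver B C → Ver A B → Ver A C
    Hor  : Obj → Obj → Set₁
    _⊙_  : ∀ {A B C} → Hor A B → Hor B C → Hor A C
    U    : ∀ A → Hor A A
    -- Cell S R f g : there is a 2-cell with top S, bottom R, left f, right g
    Cell : ∀ {A B C D} → Hor A B → Hor C D → Ver A C → Ver B D → Set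

_ᵒᵖ : ThinDbl → ThinDbl
D ᵒᵖ = record
  { Obj = Obj ; Ver = λ A B → Ver B A ; _≈v_ = _≈v_ ; idv = idv
  ; _∘v_ = λ g f → f ∘v g ; Hor = Hor ; _⊙_ = _⊙_ ; U = U
  ; Cell = λ S R f g → Cell R S f g }
  where open ThinDbl D

𝕊Pos : ThinDbl
𝕊Pos = record
  { Obj = Pos₀ ; Ver = Mono ; _≈v_ = _≈M_ ; idv = idM ; _∘v_ = _∘M_
  ; Hor = WRel ; _⊙_ = _⊙W_ ; U = UW ; Cell = CellW }

-- Since the
-- 2-cells are unique, all coherence axioms (associativity, unitality,
-- naturality of the comparison cells, functoriality on 2-cells) hold
-- automatically; what remains is the existence of the required cells.

module _ (D E : ThinDbl) where
  private
    module D = ThinDbl D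
    module E = ThinDbl E

  record IsDblFunctorData
      (F₀ : D.Obj → E.Obj)
      (Fv : ∀ {A B} → D.Ver A B → E.Ver (F₀ A) (F₀ B))
      (Fh : ∀ {A B} → D.Hor A B → E.Hor (F₀ A) (F₀ B)) : Set₁ where
    field
      Fv-cong : ∀ {A B} {f g : D.Ver A B} → f D.≈v g → Fv f E.≈v Fv g
      Fv-id   : ∀ {A} → Fv (D.idv {A}) E.≈v E.idv
      Fv-∘    : ∀ {A B C} (g : D.Ver B C) (f : D.Ver A B) →
                Fv (g D.∘v f) E.≈v (Fv g E.∘v Fv f)
      F-cell  : ∀ {A B C D'} {S : D.Hor A B} {R : D.Hor C D'}
                {f : D.Ver A C} {g : D.Ver B D'} →
                D.Cell S R f g → E.Cell (Fh S) (Fh R) (Fv f) (Fv g)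

  record IsLaxFunctor
      (F₀ : D.Obj → E.Obj)
      (Fv : ∀ {A B} → D.Ver A B → E.Ver (F₀ A) (F₀ B))
      (Fh : ∀ {A B} → D.Hor A B → E.Hor (F₀ A) (F₀ B)) : Set₁ where
    field
      functorial : IsDblFunctorData F₀ Fv Fh
      comp-cell  : ∀ {A B C} (r : D.Hor A B) (s : D.Hor B C) →
                   E.Cell (Fh r E.⊙ Fh s) (Fh (r D.⊙ s)) E.idv E.idv
      unit-cell  : ∀ A → E.Cell (E.U (F₀ A)) (Fh (D.U A)) E.idv E.idv

  record IsColaxFunctor
      (F₀ : D.Obj → E.Obj)
      (Fv : ∀ {A B} → D.Ver A B → E.Ver (F₀ A) (F₀ B))
      (Fh : ∀ {A B} → D.Hor A B → E.Hor (F₀ A) (F₀ B)) : Set₁ where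
    field
      functorial : IsDblFunctorData F₀ Fv Fh
      comp-cell  : ∀ {A B C} (r : D.Hor A B) (s : D.Hor B C) →
                   E.Cell (Fh (r D.⊙ s)) (Fh r E.⊙ Fh s) E.idv E.idv
      unit-cell  : ∀ A → E.Cell (Fh (D.U A)) (E.U (F₀ A)) E.idv E.idv

-- An adjunction F ⊣ G (F : C → D, G : D → C) in the 2-category of thin
-- double categories, double functors and vertical transformations, with
-- given unit η : Id ⇒ GF and counit ε : FG ⇒ Id. Vertical transformations
-- consist of vertical components natural w.r.t. vertical arrows and
-- horizontal components (2-cells); the remaining axioms are automatic by
-- thinness.
module _ (C D : ThinDbl) where
  private
    module C = ThinDbl C
    module D = ThinDbl D

  record IsDblAdjunction
      (F₀ : C.Obj → D.Obj)
      (Fv : ∀ {A B} → C.Ver A B → D.Ver (F₀ A) (F₀ B))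
      (Fh : ∀ {A B} → C.Hor A B → D.Hor (F₀ A) (F₀ B))
      (G₀ : D.Obj → C.Obj)
      (Gv : ∀ {A B} → D.Ver A B → C.Ver (G₀ A) (G₀ B))
      (Gh : ∀ {A B} → D.Hor A B → C.Hor (G₀ A) (G₀ B))
      (η : ∀ A → C.Ver A (G₀ (F₀ A)))
      (ε : ∀ B → D.Ver (F₀ (G₀ B)) B) : Set₁ where
    field
      η-nat    : ∀ {A B} (f : C.Ver A B) → (η B C.∘v f) C.≈v (Gv (Fv f) C.∘v η A)
      η-cell   : ∀ {A B} (r : C.Hor A B) → C.Cell r (Gh (Fh r)) (η A) (η B)
      ε-nat    : ∀ {A B} (g : D.Ver A B) → (ε B D.∘v Fv (Gv g)) D.≈v (g D.∘v ε A)
      ε-cell   : ∀ {A B} (r : D.Hor A B) → D.Cell (Fh (Gh r)) r (ε A) (ε B)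
      triangleF : ∀ A → (ε (F₀ A) D.∘v Fv (η A)) D.≈v D.idv
      triangleG : ∀ B → (Gv (ε B) C.∘v η (G₀ B)) C.≈v C.idv

  record IsFramedAdjunction
      (F₀ : C.Obj → D.Obj)
      (Fv : ∀ {A B} → C.Ver A B → D.Ver (F₀ A) (F₀ B))
      (Fh : ∀ {A B} → C.Hor A B → D.Hor (F₀ A) (F₀ B))
      (G₀ : D.Obj → C.Obj)
      (Gv : ∀ {A B} → D.Ver A B → C.Ver (G₀ A) (G₀ B))
      (Gh : ∀ {A B} → D.Hor A B → C.Hor (G₀ A) (G₀ B))
      (η : ∀ A → C.Ver A (G₀ (F₀ A)))
      (ε : ∀ B → D.Ver (F₀ (G₀ B)) B) : Set₁ where
    field
      F-lax : IsLaxFunctor C D F₀ Fv Fh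
      G-lax : IsLaxFunctor D C G₀ Gv Gh
      adj   : IsDblAdjunction F₀ Fv Fh G₀ Gv Gh η ε

  record IsOpFramedAdjunction
      (F₀ : C.Obj → D.Obj)
      (Fv : ∀ {A B} → C.Ver A B → D.Ver (F₀ A) (F₀ B))
      (Fh : ∀ {A B} → C.Hor A B → D.Hor (F₀ A) (F₀ B))
      (G₀ : D.Obj → C.Obj)
      (Gv : ∀ {A B} → D.Ver A B → C.Ver (G₀ A) (G₀ B))
      (Gh : ∀ {A B} → D.Hor A B → C.Hor (G₀ A) (G₀ B))
      (η : ∀ A → C.Ver A (G₀ (F₀ A)))
      (ε : ∀ B → D.Ver (F₀ (G₀ B)) B) : Set₁ where
    field
      F-colax : IsColaxFunctor C D F₀ Fv Fh
      G-colax : IsColaxFunctor D C G₀ Gv Gh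
      adj     : IsDblAdjunction F₀ Fv Fh G₀ Gv Gh η ε

-- Since 𝕊Pos is locally thin, every coherence condition is automatic and
-- only the existence of the structure cells has to be checked. Both
-- functors are the same assignment 𝟚^, and 𝟚̄ is in fact strictly
-- functorial on horizontal arrows: 𝟚̄(r ⊙ s) = 𝟚̄ r ⊙ 𝟚̄ s and 𝟚̄ (U X) = U (𝟚^ X).
-- Hence it is lax and colax at once, giving the framed and the op-framed
-- adjunction simultaneously. The only non-trivial inclusion is
-- 𝟚̄(r ⊙ s) ⊆ 𝟚̄ r ⊙ 𝟚̄ s, whose middle witness for (A , C) is the image r[A];
-- its characteristic map into 𝟚 is where excluded middle is needed. Unit and
-- counit are both evaluation, along which r ⊆ 𝟚̄ (𝟚̄ r).
module Submission where

open import Defs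
open import Level using (0ℓ)
open import Data.Bool using (Bool; true; false; b≤b; f≤t)
open import Data.Product using (_×_; _,_; ∃)
open import Axiom.ExcludedMiddle using (ExcludedMiddle)
open import Relation.Nullary using (Dec; does; yes)
open import Relation.Nullary.Decidable using (dec-true)
open import Relation.Binary.Bundles using (Poset)
open import Relation.Binary.Morphism.Bundles using (PosetHomomorphism)
open import Relation.Binary.PropositionalEquality using (_≡_; refl)

open Poset 𝟚 using () renaming (_≤_ to _≤𝟚_)

≤𝟚-true : ∀ {a b} → a ≤𝟚 b → a ≡ true → b ≡ true
≤𝟚-true b≤b a≡true = a≡true

true⇒true⇒≤𝟚 : ∀ {a b} → (a ≡ true → b ≡ true) → a ≤𝟚 b
true⇒true⇒≤𝟚 {false} {false} _ = b≤b
true⇒true⇒≤𝟚 {false} {true}  _ = f≤t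
true⇒true⇒≤𝟚 {true}          h with h refl
... | refl = b≤b

does≡true⇒ : ∀ {A : Set} (a? : Dec A) → does a? ≡ true → A
does≡true⇒ (yes a) _ = a

does-mono : ∀ {A B : Set} → (A → B) → (a? : Dec A) (b? : Dec B) → does a? ≤𝟚 does b?
does-mono A⇒B a? b? = true⇒true⇒≤𝟚 (λ t → dec-true b? (A⇒B (does≡true⇒ a? t)))

monotoneUpSet : (X : Pos₀) (χ : Poset.Carrier X → Bool) →
                (∀ {x y} → Poset._≤_ X x y → χ x ≤𝟚 χ y) → UpSet X
monotoneUpSet X χ χ-mono = record
  { ⟦_⟧ = χ
  ; isOrderHomomorphism = record
    { cong = λ x≈y → Poset.antisym 𝟚 (χ-mono (Poset.reflexive X x≈y))
                                     (χ-mono (Poset.reflexive X (Poset.Eq.sym X x≈y)))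
    ; mono = χ-mono } }

module Image (em : ExcludedMiddle 0ℓ) {X Y : Pos₀} (r : WRel X Y) (A : UpSet X) where

  Reached : Poset.Carrier Y → Set
  Reached y = ∃ λ x → x ∈U A × rel r x y

  image : UpSet Y
  image = monotoneUpSet Y (λ y → does (em {Reached y}))
    (λ y≤y' → does-mono (λ (x , x∈A , rxy) → x , x∈A , weak r (Poset.refl X) rxy y≤y') em em)

  ∈-image⁺ : ∀ {x y} → x ∈U A → rel r x y → y ∈U image
  ∈-image⁺ x∈A rxy = dec-true em (_ , x∈A , rxy)

  ∈-image⁻ : ∀ {y} → y ∈U image → Reached y
  ∈-image⁻ = does≡true⇒ em

open Image using (image; ∈-image⁺; ∈-image⁻)

𝟚̄⊙𝟚̄⊆𝟚̄⊙ : ∀ {X Y Z : Pos₀} (r : WRel X Y) (s : WRel Y Z) →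
           CellW (𝟚̄ r ⊙W 𝟚̄ s) (𝟚̄ (r ⊙W s)) idM idM
𝟚̄⊙𝟚̄⊆𝟚̄⊙ r s (_ , r̄AB , s̄BC) x∈A (_ , rxy , syz) = s̄BC (r̄AB x∈A rxy) syz

𝟚̄⊙⊆𝟚̄⊙𝟚̄ : ExcludedMiddle 0ℓ → ∀ {X Y Z : Pos₀} (r : WRel X Y) (s : WRel Y Z) →
           CellW (𝟚̄ (r ⊙W s)) (𝟚̄ r ⊙W 𝟚̄ s) idM idM
𝟚̄⊙⊆𝟚̄⊙𝟚̄ em r s {A} r⊙s̄AC = image em r A
                         , ∈-image⁺ em r A
                         , λ y∈rA syz → let (_ , x∈A , rxy) = ∈-image⁻ em r A y∈rA
                                        in r⊙s̄AC x∈A (_ , rxy , syz)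

U⊆𝟚̄U : (X : Pos₀) → CellW (UW (𝟚^ X)) (𝟚̄ (UW X)) idM idM
U⊆𝟚̄U X {A} A≤B x∈A x≤y = ≤𝟚-true (A≤B _) (≤𝟚-true (PosetHomomorphism.mono A x≤y) x∈A)

𝟚̄U⊆U : (X : Pos₀) → CellW (𝟚̄ (UW X)) (UW (𝟚^ X)) idM idM
𝟚̄U⊆U X ŪAB x = true⇒true⇒≤𝟚 (λ x∈A → ŪAB x∈A (Poset.refl X))

𝟚̄-cell : ∀ {A B C D : Pos₀} {S : WRel A B} {R : WRel C D} {f : Mono A C} {g : Mono B D} →
         CellW S R f g → CellW (𝟚̄ R) (𝟚̄ S) (𝟚^map f) (𝟚^map g)
𝟚̄-cell S⊆R R̄UV x∈U Sxy = R̄UV x∈U (S⊆R Sxy)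

ev-cell : ∀ {X Y : Pos₀} (r : WRel X Y) → CellW r (𝟚̄ (𝟚̄ r)) (ev X) (ev Y)
ev-cell r rxy A∈ev r̄AB = r̄AB A∈ev rxy

𝟚^map-cong : ∀ {X Y : Pos₀} {f g : Mono X Y} → f ≈M g → 𝟚^map {X} {Y} f ≈M 𝟚^map g
𝟚^map-cong f≈g A x = PosetHomomorphism.cong A (f≈g x)

𝟚^-functorialᵒᵖ : IsDblFunctorData 𝕊Pos (𝕊Pos ᵒᵖ) 𝟚^ 𝟚^map 𝟚̄
𝟚^-functorialᵒᵖ = record
  { Fv-cong = λ {_} {_} {f} {g} → 𝟚^map-cong {f = f} {g}
  ; Fv-id   = λ _ _ → refl
  ; Fv-∘    = λ _ _ _ _ → refl
  ; F-cell  = λ {_} {_} {_} {_} {S} {R} {f} {g} → 𝟚̄-cell {S = S} {R} {f} {g} }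

𝟚^-functorial : IsDblFunctorData (𝕊Pos ᵒᵖ) 𝕊Pos 𝟚^ 𝟚^map 𝟚̄
𝟚^-functorial = record
  { Fv-cong = λ {_} {_} {f} {g} → 𝟚^map-cong {f = f} {g}
  ; Fv-id   = λ _ _ → refl
  ; Fv-∘    = λ _ _ _ _ → refl
  ; F-cell  = λ {_} {_} {_} {_} {S} {R} {f} {g} → 𝟚̄-cell {S = R} {S} {f} {g} }

𝟚^-adjunction : IsDblAdjunction 𝕊Pos (𝕊Pos ᵒᵖ) 𝟚^ 𝟚^map 𝟚̄ 𝟚^ 𝟚^map 𝟚̄ ev ev
𝟚^-adjunction = record
  { η-nat     = λ _ _ _ → refl
  ; η-cell    = ev-cell
  ; ε-nat     = λ _ _ _ → refl
  ; ε-cell    = ev-cell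
  ; triangleF = λ _ _ _ → refl
  ; triangleG = λ _ _ _ → refl }

corollary7p13 : ExcludedMiddle 0ℓ →
    IsFramedAdjunction 𝕊Pos (𝕊Pos ᵒᵖ) 𝟚^ 𝟚^map 𝟚̄ 𝟚^ 𝟚^map 𝟚̄ ev ev
    × IsOpFramedAdjunction 𝕊Pos (𝕊Pos ᵒᵖ) 𝟚^ 𝟚^map 𝟚̄ 𝟚^ 𝟚^map 𝟚̄ ev ev
corollary7p13 em =
  record
    { F-lax = record { functorial = 𝟚^-functorialᵒᵖ
                     ; comp-cell  = 𝟚̄⊙⊆𝟚̄⊙𝟚̄ em ; unit-cell = 𝟚̄U⊆U }
    ; G-lax = record { functorial = 𝟚^-functorial
                     ; comp-cell  = 𝟚̄⊙𝟚̄⊆𝟚̄⊙ ; unit-cell = U⊆𝟚̄U }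
    ; adj   = 𝟚^-adjunction }
  , record
    { F-colax = record { functorial = 𝟚^-functorialᵒᵖ
                       ; comp-cell  = 𝟚̄⊙𝟚̄⊆𝟚̄⊙ ; unit-cell = U⊆𝟚̄U }
    ; G-colax = record { functorial = 𝟚^-functorial
                       ; comp-cell  = 𝟚̄⊙⊆𝟚̄⊙𝟚̄ em ; unit-cell = 𝟚̄U⊆U }
    ; adj     = 𝟚^-adjunction }
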